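{- Let $n$ be a positive integer, and for $1\leq r\leq n$ let $\nu_r(n)$ be the maximum size of a null subsemigroup of $\mathcal T_n$ whose zero element has rank $r$. Then: (i) for any $1\leq r\leq n$, $\nu_r(n)=\xi(n-r+1)$; (ii) $\nu_1(n)>\nu_2(n)>\cdots>\nu_{n-1}(n)=\nu_n(n)=1$; (iii) the maximum size $\nu(n)$ of a null subsemigroup of $\mathcal T_n$ equals $\nu_1(n)=\xi(n)$; moreover, writing $t=\alpha(n)$, the set $N_n=\{f\in\mathcal T_n : \operatorname{im}(f)\subseteq\{1,\dots,t\}\text{ and } \{1,\dots,t\}f=\{1\}\}$ is a null subsemigroup of $\mathcal T_n$ of size $\nu(n)$.
   Context: $\mathcal T_n$ is the full transformation semigroup on $\{1,\dots,n\}$ (maps written on the right); the rank of a transformation is the size of its image. A null semigroup is a semigroup $S$ with $S^2=\{z\}$ for some $z\in S$ (necessarily its zero). For $n\in\mathbb N$, $\xi(n)=\max\{t^{n-t} : t\in\{1,\dots,n\}\}$ and $\alpha(n)=\max\{t\in\{1,\dots,n\} : \xi(n)=t^{n-t}\}$, with the convention $0^0=1$. -}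

module Defs where

open import Data.Nat using (ℕ; zero; suc; _^_; _∸_; _⊔_; _<_; _≟_)
open import Data.Fin using (Fin; toℕ)
open import Data.Fin.Subset using (Subset; ∣_∣)
open import Data.Vec using (Vec; lookup; tabulate)
open import Data.List using (List; map; foldr; length)
open import Data.List.Membership.Propositional using (_∈_)
open import Data.List.Relation.Unary.Unique.Propositional using (Unique)
open import Data.Fin.Properties using (any?)
import Data.Fin as F
open import Data.Product using (Σ; _×_; ∃)
open import Relation.Nullary using (does)
open import Relation.Binary.PropositionalEquality using (_≡_)

-- A transformation of {1,…,n}, represented as {0,…,n-1} = Fin n,
-- given by its table of values: f i = lookup f i.
Transformation : ℕ → Set
Transformation n = Vec (Fin n) n

-- Composition with maps written on the right: x (f ⨾ g) = (x f) g.
_⨾_ : ∀ {n} → Transformation n → Transformation n → Transformation n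
f ⨾ g = tabulate (λ i → lookup g (lookup f i))

image : ∀ {n} → Transformation n → Subset n
image {n} f = tabulate (λ j → does (any? (λ i → lookup f i F.≟ j)))

rank : ∀ {n} → Transformation n → ℕ
rank f = ∣ image f ∣

-- A finite subset of T_n is a duplicate-free list; its size is the length.
-- S is a null subsemigroup of T_n with zero z:  z ∈ S and S S = {z}
-- (all products of elements of S equal z; closure follows).
IsNullSubsemigroup : ∀ {n} → List (Transformation n) → Transformation n → Set
IsNullSubsemigroup S z =
  Unique S × z ∈ S × (∀ f g → f ∈ S → g ∈ S → f ⨾ g ≡ z)

IsMaxNullSizeRank : ℕ → ℕ → ℕ → Set
IsMaxNullSizeRank n r m =
  (Σ (List (Transformation n)) λ S → Σ (Transformation n) λ z →
      IsNullSubsemigroup S z × rank z ≡ r × length S ≡ m)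
  × (∀ (S : List (Transformation n)) (z : Transformation n) →
      IsNullSubsemigroup S z → rank z ≡ r → Data.Nat._≤_ (length S) m)

IsMaxNullSize : ℕ → ℕ → Set
IsMaxNullSize n m =
  (Σ (List (Transformation n)) λ S → Σ (Transformation n) λ z →
      IsNullSubsemigroup S z × length S ≡ m)
  × (∀ (S : List (Transformation n)) (z : Transformation n) →
      IsNullSubsemigroup S z → Data.Nat._≤_ (length S) m)

maxOver : ℕ → (ℕ → ℕ) → ℕ
maxOver zero    h = 0
maxOver (suc k) h = h (suc k) ⊔ maxOver k h

ξ : ℕ → ℕ
ξ n = maxOver n (λ t → t ^ (n ∸ t))

αsearch : ℕ → ℕ → ℕ
αsearch n zero = 0
αsearch n (suc k) with ξ n ≟ suc k ^ (n ∸ suc k)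
... | Relation.Nullary.yes _ = suc k
... | Relation.Nullary.no  _ = αsearch n k

α : ℕ → ℕ
α n = αsearch n n

-- The set N_n (with t = α n): im f ⊆ {1..t} and {1..t} f = {1}.
-- Points 1..t are the Fin elements with toℕ < t; the point 1 is toℕ ≡ 0.
InN : ∀ n → Transformation n → Set
InN n f = (∀ i → toℕ (lookup f i) < α n)
        × (∀ i → toℕ i < α n → toℕ (lookup f i) ≡ 0)

module Submission where

-- Let S be a null subsemigroup of T_n whose zero z has rank r, and let Y be the set of points at
-- which every element of S agrees with z.  As x f g = x z = x f z, each f ∈ S maps into Y, agrees
-- with z on Y, and maps any other point y into the fibre of y z inside Y.  That fibre meets
-- im z ⊆ Y in at most one point, z being the identity on its image, so it has at most |Y| + 1 − r
-- elements, whence |S| ≤ (|Y| + 1 − r)^(n − |Y|) ≤ ξ(n − r + 1).  Conversely, for 1 ≤ t ≤ k ≤ n the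
-- maps that send {1..t} to 1, map {1..k} into {1..t} and fix every point above k form a null
-- subsemigroup of size t^(k − t) whose zero has rank n − k + 1, and a best t attains the bound.
-- Part (ii) is the strict growth of ξ from 2 on; (iii) is the case r = 1, k = n, t = α(n).

open import Level using (Level)
open import Data.Bool using (true; false; not; if_then_else_)
open import Data.Empty using (⊥-elim)
open import Data.Fin using (Fin; toℕ)
import Data.Fin as F
open import Data.Fin.Properties using (any?; toℕ<n; toℕ-injective) renaming (0≢1+n to zero≢suc)
open import Data.Fin.Subset using (Subset; ∣_∣; _∪_; _∩_; ⁅_⁆; inside; outside)
  renaming (_∈_ to _∈ₛ_; _⊆_ to _⊆ₛ_)
open import Data.Fin.Subset.Properties
  using (∣p∣≤n; ∣∁p∣≡n∸∣p∣; ∣⁅x⁆∣≡1; x∈⁅y⁆⇔x≡y; p⊆q⇒∣p∣≤∣q∣; x∈p⇒∣p-x∣<∣p∣; x∈p∪q⁻; x∈p∩q⁻)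
open import Data.List using (List; []; _∷_; [_]; _++_; length; filter; allFin; cartesianProductWith)
import Data.List as List
open import Data.List.Properties using (length-++; length-map)
open import Data.List.Membership.Propositional using (_∈_)
open import Data.List.Membership.Propositional.Properties
  using (∈-∃++; ∈-++⁻; ∈-++⁺ˡ; ∈-++⁺ʳ; ∈-cartesianProductWith⁺; ∈-cartesianProductWith⁻;
         ∈-filter⁺; ∈-filter⁻; ∈-allFin)
open import Data.List.Relation.Binary.Subset.Propositional using (_⊆_)
open import Data.List.Relation.Unary.All as All using (All; [])
open import Data.List.Relation.Unary.AllPairs using ([]; _∷_)
open import Data.List.Relation.Unary.Any using (here; there)
open import Data.List.Relation.Unary.Unique.Propositional using (Unique)
import Data.List.Relation.Unary.Unique.Propositional.Properties as Unique
open import Data.Nat using (ℕ; zero; suc; pred; _+_; _*_; _∸_; _^_; _≤_; _<_; z≤n; s≤s)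
open import Data.Nat.Properties
open import Data.Product using (Σ; ∃; ∃₂; _×_; _,_; proj₁; proj₂)
open import Data.Sum using (inj₁; inj₂)
open import Data.Vec using (Vec; _∷_; lookup; tabulate)
import Data.Vec as Vec
open import Data.Vec.Properties
  using (∷-injective; lookup∘tabulate; tabulate∘lookup; tabulate-cong; tabulate-∘; []=⇒lookup; lookup⇒[]=)
open import Function using (_∘_)
open import Function.Bundles using (_⇔_; mk⇔; Equivalence)
import Function.Properties.Equivalence as ⇔
open import Relation.Binary.PropositionalEquality
  using (_≡_; refl; sym; trans; cong; cong₂; subst; subst₂; module ≡-Reasoning)
open import Relation.Nullary using (yes; no; does)
open import Relation.Nullary.Decidable using (dec-true; dec-false; does-⇔; _×-dec_)
open import Relation.Unary using (Pred; Decidable)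
open import Relation.Unary.Properties using (∁?)

open import Defs

private variable
  a ℓ : Level
  A : Set a

-- Counting finite sets

Unique⇒length≤ : {xs ys : List A} → Unique xs → xs ⊆ ys → length xs ≤ length ys
Unique⇒length≤ {xs = []} _ _ = z≤n
Unique⇒length≤ {xs = x ∷ xs} (x∉xs ∷ xs!) xs⊆ys
  with us , vs , refl ← ∈-∃++ (xs⊆ys (here refl)) = begin
    suc (length xs)              ≤⟨ s≤s (Unique⇒length≤ xs! xs⊆us++vs) ⟩
    suc (length (us ++ vs))      ≡⟨ cong suc (length-++ us) ⟩
    suc (length us + length vs)  ≡⟨ +-suc (length us) (length vs) ⟨
    length us + length (x ∷ vs)  ≡⟨ length-++ us ⟨
    length (us ++ x ∷ vs)        ∎
  where
    open ≤-Reasoning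
    xs⊆us++vs : xs ⊆ us ++ vs
    xs⊆us++vs {y} y∈xs with ∈-++⁻ us (xs⊆ys (there y∈xs))
    ... | inj₁ y∈us         = ∈-++⁺ˡ y∈us
    ... | inj₂ (here refl)  = ⊥-elim (All.lookup x∉xs y∈xs refl)
    ... | inj₂ (there y∈vs) = ∈-++⁺ʳ us y∈vs

length-cartesianProductWith : ∀ {b c} {B : Set b} {C : Set c} (f : A → B → C) xs ys →
  length (cartesianProductWith f xs ys) ≡ length xs * length ys
length-cartesianProductWith f []       ys = refl
length-cartesianProductWith f (x ∷ xs) ys = begin
  length (List.map (f x) ys ++ cartesianProductWith f xs ys)
    ≡⟨ length-++ (List.map (f x) ys) ⟩
  length (List.map (f x) ys) + length (cartesianProductWith f xs ys)
    ≡⟨ cong₂ _+_ (length-map (f x) ys) (length-cartesianProductWith f xs ys) ⟩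
  length ys + length xs * length ys ∎
  where open ≡-Reasoning

∏ : ∀ {k} → (Fin k → ℕ) → ℕ
∏ {zero}  h = 1
∏ {suc k} h = h F.zero * ∏ (h ∘ F.suc)

choices : ∀ {k} → (Fin k → List A) → List (Vec A k)
choices {k = zero}  as = [ Vec.[] ]
choices {k = suc k} as = cartesianProductWith _∷_ (as F.zero) (choices (as ∘ F.suc))

∈-choices⁺ : ∀ {k} (as : Fin k → List A) {v : Vec A k} → (∀ i → lookup v i ∈ as i) → v ∈ choices as
∈-choices⁺ {k = zero}  as {Vec.[]} _ = here refl
∈-choices⁺ {k = suc k} as {x ∷ v} v∈as =
  ∈-cartesianProductWith⁺ _∷_ (v∈as F.zero) (∈-choices⁺ (as ∘ F.suc) (v∈as ∘ F.suc))

∈-choices⁻ : ∀ {k} (as : Fin k → List A) {v : Vec A k} → v ∈ choices as → ∀ i → lookup v i ∈ as i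
∈-choices⁻ {k = suc k} as v∈ i
  with x , w , x∈ , w∈ , refl ← ∈-cartesianProductWith⁻ _∷_ (as F.zero) (choices (as ∘ F.suc)) v∈
  with i
... | F.zero  = x∈
... | F.suc i = ∈-choices⁻ (as ∘ F.suc) w∈ i

choices-unique : ∀ {k} (as : Fin k → List A) → (∀ i → Unique (as i)) → Unique (choices as)
choices-unique {k = zero}  as _    = [] ∷ []
choices-unique {k = suc k} as as! =
  Unique.cartesianProductWith⁺ _∷_ ∷-injective (as! F.zero) (choices-unique (as ∘ F.suc) (as! ∘ F.suc))

length-choices : ∀ {k} (as : Fin k → List A) → length (choices as) ≡ ∏ (length ∘ as)
length-choices {k = zero}  as = refl
length-choices {k = suc k} as =
  trans (length-cartesianProductWith _∷_ (as F.zero) _)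
        (cong (length (as F.zero) *_) (length-choices (as ∘ F.suc)))

∏-mono-≤ : ∀ {k} {g h : Fin k → ℕ} → (∀ i → g i ≤ h i) → ∏ g ≤ ∏ h
∏-mono-≤ {k = zero}  g≤h = ≤-refl
∏-mono-≤ {k = suc k} g≤h = *-mono-≤ (g≤h F.zero) (∏-mono-≤ (g≤h ∘ F.suc))

∏-cong : ∀ {k} {g h : Fin k → ℕ} → (∀ i → g i ≡ h i) → ∏ g ≡ ∏ h
∏-cong {k = zero}  g≗h = refl
∏-cong {k = suc k} g≗h = cong₂ _*_ (g≗h F.zero) (∏-cong (g≗h ∘ F.suc))

⟦_⟧ : ∀ {n} {P : Pred (Fin n) ℓ} → Decidable P → Subset n
⟦ P? ⟧ = tabulate (does ∘ P?)

module _ {n} {P : Pred (Fin n) ℓ} (P? : Decidable P) where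

  ∈⟦⟧⁺ : ∀ {i} → P i → i ∈ₛ ⟦ P? ⟧
  ∈⟦⟧⁺ {i} p = lookup⇒[]= i ⟦ P? ⟧ (trans (lookup∘tabulate (does ∘ P?) i) (dec-true (P? i) p))

  ∈⟦⟧⁻ : ∀ {i} → i ∈ₛ ⟦ P? ⟧ → P i
  ∈⟦⟧⁻ {i} i∈ with P? i | trans (sym (lookup∘tabulate (does ∘ P?) i)) ([]=⇒lookup i∈)
  ... | yes p | _ = p
  ... | no _  | ()

  elements : List (Fin n)
  elements = filter P? (allFin n)

  ∈-elements⁺ : ∀ {i} → P i → i ∈ elements
  ∈-elements⁺ p = ∈-filter⁺ P? (∈-allFin _) p

  ∈-elements⁻ : ∀ {i} → i ∈ elements → P i
  ∈-elements⁻ i∈ = proj₂ (∈-filter⁻ P? {xs = allFin n} i∈)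

  elements-unique : Unique elements
  elements-unique = Unique.filter⁺ P? (Unique.allFin⁺ n)

  ∣⟦∁⟧∣≡n∸∣⟦⟧∣ : ∣ ⟦ ∁? P? ⟧ ∣ ≡ n ∸ ∣ ⟦ P? ⟧ ∣
  ∣⟦∁⟧∣≡n∸∣⟦⟧∣ = trans (cong ∣_∣ (tabulate-∘ not (does ∘ P?))) (∣∁p∣≡n∸∣p∣ ⟦ P? ⟧)

length-filter-tabulate : ∀ {n} {P : Pred A ℓ} (P? : Decidable P) (f : Fin n → A) →
  length (filter P? (List.tabulate f)) ≡ ∣ ⟦ P? ∘ f ⟧ ∣
length-filter-tabulate {n = zero}  P? f = refl
length-filter-tabulate {n = suc n} P? f with does (P? (f F.zero))
... | true  = cong suc (length-filter-tabulate P? (f ∘ F.suc))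
... | false = length-filter-tabulate P? (f ∘ F.suc)

length-elements : ∀ {n} {P : Pred (Fin n) ℓ} (P? : Decidable P) → length (elements P?) ≡ ∣ ⟦ P? ⟧ ∣
length-elements P? = length-filter-tabulate P? (λ i → i)

∣⟦⟧∣-cong : ∀ {n} {P Q : Pred (Fin n) ℓ} (P? : Decidable P) (Q? : Decidable Q) →
  (∀ i → P i ⇔ Q i) → ∣ ⟦ P? ⟧ ∣ ≡ ∣ ⟦ Q? ⟧ ∣
∣⟦⟧∣-cong P? Q? P⇔Q = cong ∣_∣ (tabulate-cong (λ i → does-⇔ (P⇔Q i) (P? i) (Q? i)))

∣⟦⟧∣-suc : ∀ {n} {P : Pred (Fin (suc n)) ℓ} (P? : Decidable P) → P F.zero →
  ∣ ⟦ P? ⟧ ∣ ≡ suc ∣ ⟦ P? ∘ F.suc ⟧ ∣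
∣⟦⟧∣-suc P? p with P? F.zero
... | yes _ = refl
... | no ¬p = ⊥-elim (¬p p)

∣p∪q∣+∣p∩q∣≡∣p∣+∣q∣ : ∀ {n} (p q : Subset n) → ∣ p ∪ q ∣ + ∣ p ∩ q ∣ ≡ ∣ p ∣ + ∣ q ∣
∣p∪q∣+∣p∩q∣≡∣p∣+∣q∣ Vec.[] Vec.[] = refl
∣p∪q∣+∣p∩q∣≡∣p∣+∣q∣ (outside ∷ p) (outside ∷ q) = ∣p∪q∣+∣p∩q∣≡∣p∣+∣q∣ p q
∣p∪q∣+∣p∩q∣≡∣p∣+∣q∣ (inside  ∷ p) (outside ∷ q) = cong suc (∣p∪q∣+∣p∩q∣≡∣p∣+∣q∣ p q)
∣p∪q∣+∣p∩q∣≡∣p∣+∣q∣ (outside ∷ p) (inside  ∷ q) =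
  trans (cong suc (∣p∪q∣+∣p∩q∣≡∣p∣+∣q∣ p q)) (sym (+-suc ∣ p ∣ ∣ q ∣))
∣p∪q∣+∣p∩q∣≡∣p∣+∣q∣ (inside  ∷ p) (inside  ∷ q) = cong suc (begin
  ∣ p ∪ q ∣ + suc ∣ p ∩ q ∣   ≡⟨ +-suc ∣ p ∪ q ∣ ∣ p ∩ q ∣ ⟩
  suc (∣ p ∪ q ∣ + ∣ p ∩ q ∣) ≡⟨ cong suc (∣p∪q∣+∣p∩q∣≡∣p∣+∣q∣ p q) ⟩
  suc (∣ p ∣ + ∣ q ∣)         ≡⟨ +-suc ∣ p ∣ ∣ q ∣ ⟨
  ∣ p ∣ + suc ∣ q ∣           ∎)
  where open ≡-Reasoning

InRange : ∀ {n} → ℕ → ℕ → Pred (Fin n) _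
InRange a b i = a ≤ toℕ i × toℕ i < b

inRange? : ∀ {n} (a b : ℕ) → Decidable (InRange {n} a b)
inRange? a b i = a ≤? toℕ i ×-dec toℕ i <? b

InRange-suc : ∀ {n} a b (i : Fin n) → InRange a b (F.suc i) ⇔ InRange (pred a) (pred b) i
InRange-suc a b i =
  mk⇔ (λ (a≤ , <b) → lower a a≤ , shift b <b) (λ (a≤ , <b) → raise a a≤ , unshift b <b)
  where
    lower : ∀ a → a ≤ suc (toℕ i) → pred a ≤ toℕ i
    lower zero    _         = z≤n
    lower (suc a) (s≤s a≤i) = a≤i
    raise : ∀ a → pred a ≤ toℕ i → a ≤ suc (toℕ i)
    raise zero    _   = z≤n
    raise (suc a) a≤i = s≤s a≤i
    shift : ∀ b → suc (toℕ i) < b → toℕ i < pred b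
    shift (suc b) (s≤s i<b) = i<b
    unshift : ∀ b → toℕ i < pred b → suc (toℕ i) < b
    unshift (suc b) i<b = s≤s i<b

∣range∣-shift : ∀ {n} a b →
  ∣ ⟦ inRange? {suc n} a b ∘ F.suc ⟧ ∣ ≡ ∣ ⟦ inRange? {n} (pred a) (pred b) ⟧ ∣
∣range∣-shift {n} a b =
  ∣⟦⟧∣-cong (inRange? a b ∘ F.suc) (inRange? (pred a) (pred b)) (InRange-suc {n} a b)

∣range∣≡b∸a : ∀ {n} a b → a ≤ b → b ≤ n → ∣ ⟦ inRange? {n} a b ⟧ ∣ ≡ b ∸ a
∣range∣≡b∸a {zero} .zero .zero z≤n z≤n = refl
∣range∣≡b∸a {suc n} zero zero _ _ =
  trans (∣range∣-shift {n} 0 0) (∣range∣≡b∸a {n} 0 0 z≤n z≤n)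
∣range∣≡b∸a {suc n} zero (suc b) _ (s≤s b≤n) =
  cong suc (trans (∣range∣-shift {n} 0 (suc b)) (∣range∣≡b∸a 0 b z≤n b≤n))
∣range∣≡b∸a {suc n} (suc a) (suc b) (s≤s a≤b) (s≤s b≤n) =
  trans (∣range∣-shift {n} (suc a) (suc b)) (∣range∣≡b∸a a b a≤b b≤n)

∏-indicator : ∀ {k} (p : Subset k) c → ∏ (λ i → if lookup p i then c else 1) ≡ c ^ ∣ p ∣
∏-indicator Vec.[]          c = refl
∏-indicator (inside  ∷ p) c = cong (c *_) (∏-indicator p c)
∏-indicator (outside ∷ p) c = trans (+-identityʳ _) (∏-indicator p c)

-- ξ and α

h≤maxOver : ∀ {k t} h → 1 ≤ t → t ≤ k → h t ≤ maxOver k h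
h≤maxOver {zero} {suc t} h _ ()
h≤maxOver {suc k} {t} h 1≤t t≤1+k with m≤n⇒m<n∨m≡n t≤1+k
... | inj₁ (s≤s t≤k) = ≤-trans (h≤maxOver h 1≤t t≤k) (m≤n⊔m (h (suc k)) (maxOver k h))
... | inj₂ refl      = m≤m⊔n (h (suc k)) (maxOver k h)

maxOver-attained : ∀ k h → 1 ≤ k → ∃ λ t → 1 ≤ t × t ≤ k × maxOver k h ≡ h t
maxOver-attained (suc zero)    h _ = 1 , ≤-refl , ≤-refl , ⊔-identityʳ (h 1)
maxOver-attained (suc (suc k)) h _
  with t , 1≤t , t≤ , rest≡ht ← maxOver-attained (suc k) h (s≤s z≤n)
  with ⊔-sel (h (suc (suc k))) (maxOver (suc k) h)
... | inj₁ max≡last = suc (suc k) , s≤s z≤n , ≤-refl , max≡last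
... | inj₂ max≡rest = t , 1≤t , m≤n⇒m≤1+n t≤ , trans max≡rest rest≡ht

pow≤ξ : ∀ t e → suc t ^ e ≤ ξ (suc t + e)
pow≤ξ t e = subst (λ x → suc t ^ x ≤ ξ (suc t + e)) (m+n∸m≡n (suc t) e)
  (h≤maxOver (λ s → s ^ (suc t + e ∸ s)) (s≤s z≤n) (m≤m+n (suc t) e))

ξ-attained : ∀ K → 1 ≤ K → ∃₂ λ t e → K ≡ suc t + e × ξ K ≡ suc t ^ e
ξ-attained K 1≤K with maxOver-attained K (λ s → s ^ (K ∸ s)) 1≤K
... | suc t , _ , t<K , ξK≡ = t , K ∸ suc t , sym (m+[n∸m]≡n t<K) , ξK≡

ξ-≤-suc : ∀ K → ξ K ≤ ξ (suc K)
ξ-≤-suc zero = z≤n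
ξ-≤-suc (suc K) with t , e , refl , ξK≡ ← ξ-attained (suc K) (s≤s z≤n) = begin
  ξ (suc t + e)       ≡⟨ ξK≡ ⟩
  suc t ^ e           ≤⟨ ^-monoʳ-≤ (suc t) (n≤1+n e) ⟩
  suc t ^ suc e       ≤⟨ pow≤ξ t (suc e) ⟩
  ξ (suc t + suc e)   ≡⟨ cong ξ (+-suc (suc t) e) ⟩
  ξ (suc (suc t + e)) ∎
  where open ≤-Reasoning

ξ-mono-≤ : ∀ {m n} → m ≤ n → ξ m ≤ ξ n
ξ-mono-≤ {n = zero} z≤n = ≤-refl
ξ-mono-≤ {n = suc n} m≤1+n with m≤n⇒m<n∨m≡n m≤1+n
... | inj₁ (s≤s m≤n) = ≤-trans (ξ-mono-≤ m≤n) (ξ-≤-suc n)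
... | inj₂ refl      = ≤-refl

ξ-<-suc : ∀ K → 2 ≤ K → ξ K < ξ (suc K)
ξ-<-suc K 2≤K with ξ-attained K (≤-trans (s≤s z≤n) 2≤K)
ξ-<-suc _ (s≤s (s≤s z≤n)) | zero , suc e , refl , ξK≡ = begin-strict
  ξ (suc (suc e))     ≡⟨ trans ξK≡ (^-zeroˡ (suc e)) ⟩
  1                   <⟨ ^-monoʳ-< 2 ≤-refl {0} {suc e} (s≤s z≤n) ⟩
  2 ^ suc e           ≤⟨ pow≤ξ 1 (suc e) ⟩
  ξ (2 + suc e)       ∎
  where open ≤-Reasoning
... | suc t , e , refl , ξK≡ = begin-strict
  ξ (suc (suc t) + e)       ≡⟨ ξK≡ ⟩
  suc (suc t) ^ e           <⟨ ^-monoʳ-< (suc (suc t)) (s≤s (s≤s z≤n)) (n<1+n e) ⟩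
  suc (suc t) ^ suc e       ≤⟨ pow≤ξ (suc t) (suc e) ⟩
  ξ (suc (suc t) + suc e)   ≡⟨ cong ξ (+-suc (suc (suc t)) e) ⟩
  ξ (suc (suc (suc t) + e)) ∎
  where open ≤-Reasoning

αsearch-attained : ∀ n k t → 1 ≤ t → t ≤ k → ξ n ≡ t ^ (n ∸ t) →
  1 ≤ αsearch n k × αsearch n k ≤ k × ξ n ≡ αsearch n k ^ (n ∸ αsearch n k)
αsearch-attained n zero    t (s≤s z≤n) ()
αsearch-attained n (suc k) t 1≤t t≤1+k ξn≡ with ξ n ≟ suc k ^ (n ∸ suc k)
... | yes ξn≡last = s≤s z≤n , ≤-refl , ξn≡last
... | no ξn≢last with m≤n⇒m<n∨m≡n t≤1+k
...   | inj₁ (s≤s t≤k) =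
          let 1≤α , α≤k , ξn≡α = αsearch-attained n k t 1≤t t≤k ξn≡ in 1≤α , m≤n⇒m≤1+n α≤k , ξn≡α
...   | inj₂ refl = ⊥-elim (ξn≢last ξn≡)

α-attained : ∀ n → 1 ≤ n → 1 ≤ α n × α n ≤ n × ξ n ≡ α n ^ (n ∸ α n)
α-attained n 1≤n with maxOver-attained n (λ s → s ^ (n ∸ s)) 1≤n
... | t , 1≤t , t≤n , ξn≡ = αsearch-attained n n t 1≤t t≤n ξn≡

[1+m∸r]^[n∸m]≤ξ[n∸r+1] : ∀ {r m n} → r ≤ m → m ≤ n → (suc m ∸ r) ^ (n ∸ m) ≤ ξ (n ∸ r + 1)
[1+m∸r]^[n∸m]≤ξ[n∸r+1] {r} {m} {n} r≤m m≤n =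
  subst₂ (λ b K → b ^ (n ∸ m) ≤ ξ K) (sym (+-∸-assoc 1 r≤m)) size≡ (pow≤ξ (m ∸ r) (n ∸ m))
  where
    open ≡-Reasoning
    size≡ : suc (m ∸ r) + (n ∸ m) ≡ n ∸ r + 1
    size≡ = begin
      suc ((m ∸ r) + (n ∸ m)) ≡⟨ cong suc (+-comm (m ∸ r) (n ∸ m)) ⟩
      suc ((n ∸ m) + (m ∸ r)) ≡⟨ cong suc (+-∸-assoc (n ∸ m) r≤m) ⟨
      suc ((n ∸ m) + m ∸ r)   ≡⟨ cong (λ x → suc (x ∸ r)) (m∸n+n≡m m≤n) ⟩
      suc (n ∸ r)             ≡⟨ +-comm 1 (n ∸ r) ⟩
      n ∸ r + 1               ∎

-- The upper bound

inImage? : ∀ {n} (f : Transformation n) → Decidable (λ y → ∃ λ x → lookup f x ≡ y)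
inImage? f y = any? (λ x → lookup f x F.≟ y)

rank-positive : ∀ {n} (f : Transformation (suc n)) → 1 ≤ rank f
rank-positive f = ≤-trans (s≤s z≤n) (x∈p⇒∣p-x∣<∣p∣ (∈⟦⟧⁺ (inImage? f) (F.zero , refl)))

module NullSubsemigroup {n} {S : List (Transformation n)} {z : Transformation n}
                        (S-null : IsNullSubsemigroup S z) where

  z∈S : z ∈ S
  z∈S = proj₁ (proj₂ S-null)

  composite≡zero : ∀ {f g} → f ∈ S → g ∈ S → ∀ x → lookup g (lookup f x) ≡ lookup z x
  composite≡zero {f} {g} f∈S g∈S x =
    trans (sym (lookup∘tabulate (λ i → lookup g (lookup f i)) x))
          (cong (λ h → lookup h x) (proj₂ (proj₂ S-null) f g f∈S g∈S))

  Agrees : Pred (Fin n) _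
  Agrees y = All (λ g → lookup g y ≡ lookup z y) S

  agrees? : Decidable Agrees
  agrees? y = All.all? (λ g → lookup g y F.≟ lookup z y) S

  image⊆Agrees : ∀ {f} → f ∈ S → ∀ x → Agrees (lookup f x)
  image⊆Agrees f∈S x =
    All.tabulate λ g∈S → trans (composite≡zero f∈S g∈S x) (sym (composite≡zero f∈S z∈S x))

  InFibre : Fin n → Pred (Fin n) _
  InFibre j y = Agrees y × lookup z y ≡ j

  inFibre? : ∀ j → Decidable (InFibre j)
  inFibre? j y = agrees? y ×-dec lookup z y F.≟ j

  candidates : Fin n → List (Fin n)
  candidates i with agrees? i
  ... | yes _ = [ lookup z i ]
  ... | no  _ = elements (inFibre? (lookup z i))

  S⊆choices : S ⊆ choices candidates
  S⊆choices {f} f∈S = ∈-choices⁺ candidates fi∈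
    where
      fi∈ : ∀ i → lookup f i ∈ candidates i
      fi∈ i with agrees? i
      ... | yes agrees = here (All.lookup agrees f∈S)
      ... | no  _      =
        ∈-elements⁺ (inFibre? (lookup z i)) (image⊆Agrees f∈S i , composite≡zero f∈S z∈S i)

  image⊆agreement : image z ⊆ₛ ⟦ agrees? ⟧
  image⊆agreement y∈ with x , zx≡y ← ∈⟦⟧⁻ (inImage? z) y∈ =
    ∈⟦⟧⁺ agrees? (subst Agrees zx≡y (image⊆Agrees z∈S x))

  rank≤agreement : rank z ≤ ∣ ⟦ agrees? ⟧ ∣
  rank≤agreement = p⊆q⇒∣p∣≤∣q∣ image⊆agreement

  fibre+rank≤ : ∀ j → ∣ ⟦ inFibre? j ⟧ ∣ + rank z ≤ suc ∣ ⟦ agrees? ⟧ ∣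
  fibre+rank≤ j = begin
    ∣ Fj ∣ + ∣ image z ∣                    ≡⟨ ∣p∪q∣+∣p∩q∣≡∣p∣+∣q∣ Fj (image z) ⟨
    ∣ Fj ∪ image z ∣ + ∣ Fj ∩ image z ∣     ≤⟨ +-mono-≤ (p⊆q⇒∣p∣≤∣q∣ ∪⊆agreement) (p⊆q⇒∣p∣≤∣q∣ ∩⊆⁅j⁆) ⟩
    ∣ ⟦ agrees? ⟧ ∣ + ∣ ⁅ j ⁆ ∣             ≡⟨ cong (∣ ⟦ agrees? ⟧ ∣ +_) (∣⁅x⁆∣≡1 j) ⟩
    ∣ ⟦ agrees? ⟧ ∣ + 1                     ≡⟨ +-comm ∣ ⟦ agrees? ⟧ ∣ 1 ⟩
    suc ∣ ⟦ agrees? ⟧ ∣                     ∎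
    where
      open ≤-Reasoning
      Fj = ⟦ inFibre? j ⟧
      ∪⊆agreement : Fj ∪ image z ⊆ₛ ⟦ agrees? ⟧
      ∪⊆agreement y∈ with x∈p∪q⁻ Fj (image z) y∈
      ... | inj₁ y∈Fj = ∈⟦⟧⁺ agrees? (proj₁ (∈⟦⟧⁻ (inFibre? j) y∈Fj))
      ... | inj₂ y∈I  = image⊆agreement y∈I
      ∩⊆⁅j⁆ : Fj ∩ image z ⊆ₛ ⁅ j ⁆
      ∩⊆⁅j⁆ y∈ with y∈Fj , y∈I ← x∈p∩q⁻ Fj (image z) y∈ with x , refl ← ∈⟦⟧⁻ (inImage? z) y∈I =
        Equivalence.from x∈⁅y⁆⇔x≡y
          (trans (sym (composite≡zero z∈S z∈S x)) (proj₂ (∈⟦⟧⁻ (inFibre? j) y∈Fj)))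

  disagreement : Subset n
  disagreement = ⟦ ∁? agrees? ⟧

  choiceBound : ℕ
  choiceBound = suc ∣ ⟦ agrees? ⟧ ∣ ∸ rank z

  length-candidates≤ : ∀ i → length (candidates i) ≤ (if lookup disagreement i then choiceBound else 1)
  length-candidates≤ i rewrite lookup∘tabulate (does ∘ ∁? agrees?) i with agrees? i
  ... | yes _ = ≤-refl
  ... | no  _ = m+n≤o⇒m≤o∸n (length (elements (inFibre? (lookup z i))))
                  (subst (λ m → m + rank z ≤ _) (sym (length-elements (inFibre? (lookup z i))))
                         (fibre+rank≤ (lookup z i)))

  length≤ξ : length S ≤ ξ (n ∸ rank z + 1)
  length≤ξ = begin
    length S                                  ≤⟨ Unique⇒length≤ (proj₁ S-null) S⊆choices ⟩
    length (choices candidates)               ≡⟨ length-choices candidates ⟩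
    ∏ (length ∘ candidates)                   ≤⟨ ∏-mono-≤ length-candidates≤ ⟩
    ∏ (λ i → if lookup disagreement i then choiceBound else 1)
                                              ≡⟨ ∏-indicator disagreement choiceBound ⟩
    choiceBound ^ ∣ disagreement ∣            ≡⟨ cong (choiceBound ^_) (∣⟦∁⟧∣≡n∸∣⟦⟧∣ agrees?) ⟩
    choiceBound ^ (n ∸ ∣ ⟦ agrees? ⟧ ∣)       ≤⟨ [1+m∸r]^[n∸m]≤ξ[n∸r+1] rank≤agreement (∣p∣≤n ⟦ agrees? ⟧) ⟩
    ξ (n ∸ rank z + 1)                        ∎
    where open ≤-Reasoning

-- The construction

-- Points are 0, …, n.  N consists of the maps that send [0, t) to 0, map [0, k) into [0, t) and fix
-- [k, n]; for k = n + 1 and t = α (n + 1) this is the paper's N_(n+1).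
module Construction {n : ℕ} (t k : ℕ) (1≤t : 1 ≤ t) (t≤k : t ≤ k) (k≤1+n : k ≤ suc n) where

  Point : Set
  Point = Fin (suc n)

  data Zone (i : Point) : Set where
    killed   : toℕ i < t → Zone i
    squeezed : t ≤ toℕ i → toℕ i < k → Zone i
    fixed    : k ≤ toℕ i → Zone i

  zone : ∀ i → Zone i
  zone i with toℕ i <? t | toℕ i <? k
  ... | yes i<t | _       = killed i<t
  ... | no  i≮t | yes i<k = squeezed (≮⇒≥ i≮t) i<k
  ... | no  _   | no  i≮k = fixed (≮⇒≥ i≮k)

  below? : Decidable (λ (y : Point) → toℕ y < t)
  below? y = toℕ y <? t

  candidates : Point → List Point
  candidates i with zone i
  ... | killed _     = [ F.zero ]
  ... | squeezed _ _ = elements below?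
  ... | fixed _      = [ i ]

  Allowed : Point → Point → Set
  Allowed i y = (toℕ i < t → y ≡ F.zero) × (toℕ i < k → toℕ y < t) × (k ≤ toℕ i → y ≡ i)

  ∈-candidates⇔ : ∀ i y → y ∈ candidates i ⇔ Allowed i y
  ∈-candidates⇔ i y with zone i
  ... | killed i<t = mk⇔
    (λ { (here refl) → (λ _ → refl) , (λ _ → 1≤t) , (λ k≤i → ⊥-elim (<⇒≱ (<-≤-trans i<t t≤k) k≤i)) })
    (λ (kill , _ , _) → here (kill i<t))
  ... | squeezed t≤i i<k = mk⇔
    (λ y∈ → (λ i<t → ⊥-elim (<⇒≱ i<t t≤i))
          , (λ _ → ∈-elements⁻ below? y∈)
          , (λ k≤i → ⊥-elim (<⇒≱ i<k k≤i)))
    (λ (_ , squeeze , _) → ∈-elements⁺ below? (squeeze i<k))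
  ... | fixed k≤i = mk⇔
    (λ { (here refl) → (λ i<t → ⊥-elim (<⇒≱ (<-≤-trans i<t t≤k) k≤i))
                     , (λ i<k → ⊥-elim (<⇒≱ i<k k≤i))
                     , (λ _ → refl) })
    (λ (_ , _ , fix) → here (fix k≤i))

  N : List (Transformation (suc n))
  N = choices candidates

  ∈N⇔ : ∀ f → f ∈ N ⇔ (∀ i → Allowed i (lookup f i))
  ∈N⇔ f = mk⇔
    (λ f∈N i → Equivalence.to (∈-candidates⇔ i _) (∈-choices⁻ candidates f∈N i))
    (λ allowed → ∈-choices⁺ candidates (λ i → Equivalence.from (∈-candidates⇔ i _) (allowed i)))

  zeroAt : Point → Point
  zeroAt i with zone i
  ... | fixed _ = i
  ... | _       = F.zero

  zeroMap : Transformation (suc n)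
  zeroMap = tabulate zeroAt

  zeroMap-below : ∀ {i} → toℕ i < k → lookup zeroMap i ≡ F.zero
  zeroMap-below {i} i<k rewrite lookup∘tabulate zeroAt i with zone i
  ... | killed _     = refl
  ... | squeezed _ _ = refl
  ... | fixed k≤i    = ⊥-elim (<⇒≱ i<k k≤i)

  zeroMap-above : ∀ {i} → k ≤ toℕ i → lookup zeroMap i ≡ i
  zeroMap-above {i} k≤i rewrite lookup∘tabulate zeroAt i with zone i
  ... | killed i<t       = ⊥-elim (<⇒≱ (<-≤-trans i<t t≤k) k≤i)
  ... | squeezed _ i<k   = ⊥-elim (<⇒≱ i<k k≤i)
  ... | fixed _          = refl

  zeroMap∈N : zeroMap ∈ N
  zeroMap∈N = Equivalence.from (∈N⇔ zeroMap) λ i →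
      (λ i<t → zeroMap-below (<-≤-trans i<t t≤k))
    , (λ i<k → subst (λ y → toℕ y < t) (sym (zeroMap-below i<k)) 1≤t)
    , zeroMap-above

  N-null : ∀ f g → f ∈ N → g ∈ N → f ⨾ g ≡ zeroMap
  N-null f g f∈N g∈N = trans (tabulate-cong gf≗zero) (tabulate∘lookup zeroMap)
    where
      f-allowed = Equivalence.to (∈N⇔ f) f∈N
      g-allowed = Equivalence.to (∈N⇔ g) g∈N
      gf≗zero : ∀ i → lookup g (lookup f i) ≡ lookup zeroMap i
      gf≗zero i with toℕ i <? k
      ... | yes i<k = trans (proj₁ (g-allowed (lookup f i)) (proj₁ (proj₂ (f-allowed i)) i<k))
                            (sym (zeroMap-below i<k))
      ... | no  i≮k = let k≤i = ≮⇒≥ i≮k in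
          trans (cong (lookup g) (proj₂ (proj₂ (f-allowed i)) k≤i))
                (trans (proj₂ (proj₂ (g-allowed i)) k≤i) (sym (zeroMap-above k≤i)))

  N-unique : Unique N
  N-unique = choices-unique candidates candidates-unique
    where
      candidates-unique : ∀ i → Unique (candidates i)
      candidates-unique i with zone i
      ... | killed _     = [] ∷ []
      ... | squeezed _ _ = elements-unique below?
      ... | fixed _      = [] ∷ []

  N-isNull : IsNullSubsemigroup N zeroMap
  N-isNull = N-unique , zeroMap∈N , N-null

  squeezedSet : Subset (suc n)
  squeezedSet = ⟦ inRange? t k ⟧

  length-candidates : ∀ i → length (candidates i) ≡ (if lookup squeezedSet i then t else 1)
  length-candidates i rewrite lookup∘tabulate (does ∘ inRange? {suc n} t k) i with zone i
  ... | killed i<t rewrite dec-false (inRange? t k i) (λ (t≤i , _) → <⇒≱ i<t t≤i) = refl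
  ... | squeezed t≤i i<k rewrite dec-true (inRange? t k i) (t≤i , i<k) = begin
    length (elements below?)      ≡⟨ length-elements below? ⟩
    ∣ ⟦ below? ⟧ ∣                ≡⟨ ∣⟦⟧∣-cong below? (inRange? 0 t) (λ _ → mk⇔ (z≤n ,_) proj₂) ⟩
    ∣ ⟦ inRange? {suc n} 0 t ⟧ ∣  ≡⟨ ∣range∣≡b∸a 0 t z≤n (≤-trans t≤k k≤1+n) ⟩
    t                             ∎
    where open ≡-Reasoning
  ... | fixed k≤i rewrite dec-false (inRange? t k i) (λ (_ , i<k) → <⇒≱ i<k k≤i) = refl

  length-N : length N ≡ t ^ (k ∸ t)
  length-N = begin
    length N                                         ≡⟨ length-choices candidates ⟩
    ∏ (length ∘ candidates)                          ≡⟨ ∏-cong length-candidates ⟩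
    ∏ (λ i → if lookup squeezedSet i then t else 1)  ≡⟨ ∏-indicator squeezedSet t ⟩
    t ^ ∣ squeezedSet ∣                              ≡⟨ cong (t ^_) (∣range∣≡b∸a t k t≤k k≤1+n) ⟩
    t ^ (k ∸ t)                                      ∎
    where open ≡-Reasoning

  rank-zeroMap : rank zeroMap ≡ suc (n ∸ pred k)
  rank-zeroMap = begin
    rank zeroMap
      ≡⟨ ∣⟦⟧∣-suc (inImage? zeroMap) zero∈image ⟩
    suc ∣ ⟦ inImage? zeroMap ∘ F.suc ⟧ ∣
      ≡⟨ cong suc (∣⟦⟧∣-cong (inImage? zeroMap ∘ F.suc) (inRange? (pred k) n) suc∈image⇔) ⟩
    suc ∣ ⟦ inRange? {n} (pred k) n ⟧ ∣
      ≡⟨ cong suc (∣range∣≡b∸a (pred k) n (pred-mono-≤ k≤1+n) ≤-refl) ⟩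
    suc (n ∸ pred k)
      ∎
    where
      open ≡-Reasoning
      zero∈image : ∃ λ x → lookup zeroMap x ≡ F.zero
      zero∈image = F.zero , zeroMap-below (≤-trans 1≤t t≤k)
      suc∈image⇔ : ∀ j → (∃ λ x → lookup zeroMap x ≡ F.suc j) ⇔ InRange (pred k) n j
      suc∈image⇔ j = ⇔.trans (mk⇔ to from) (InRange-suc k (suc n) j)
        where
          to : (∃ λ x → lookup zeroMap x ≡ F.suc j) → InRange k (suc n) (F.suc j)
          to (x , zx≡sj) with toℕ x <? k
          ... | yes x<k = ⊥-elim (zero≢suc (trans (sym (zeroMap-below x<k)) zx≡sj))
          ... | no  x≮k =
              subst (λ y → k ≤ toℕ y) (trans (sym (zeroMap-above (≮⇒≥ x≮k))) zx≡sj) (≮⇒≥ x≮k)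
            , toℕ<n (F.suc j)
          from : InRange k (suc n) (F.suc j) → ∃ λ x → lookup zeroMap x ≡ F.suc j
          from (k≤sj , _) = F.suc j , zeroMap-above k≤sj

[1+n∸r]+1≤1+n : ∀ n r → 1 ≤ r → suc n ∸ r + 1 ≤ suc n
[1+n∸r]+1≤1+n n (suc r) _ = subst (_≤ suc n) (+-comm 1 (n ∸ r)) (s≤s (m∸n≤m n r))

nullSubsemigroupOfRank : ∀ {n} r → 1 ≤ r → r ≤ suc n →
  Σ (List (Transformation (suc n))) λ S → Σ (Transformation (suc n)) λ z →
    IsNullSubsemigroup S z × rank z ≡ r × length S ≡ ξ (suc n ∸ r + 1)
nullSubsemigroupOfRank {n} (suc r) 1≤r (s≤s r≤n)
  with t , e , K≡ , ξK≡ ← ξ-attained (n ∸ r + 1) (m≤n+m 1 (n ∸ r)) =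
  N , zeroMap , N-isNull , rank≡ , length≡
  where
    t≤K : suc t ≤ n ∸ r + 1
    t≤K = subst (suc t ≤_) (sym K≡) (m≤m+n (suc t) e)
    open Construction {n} (suc t) (n ∸ r + 1) (s≤s z≤n) t≤K ([1+n∸r]+1≤1+n n (suc r) 1≤r)
    open ≡-Reasoning
    rank≡ : rank zeroMap ≡ suc r
    rank≡ = begin
      rank zeroMap                ≡⟨ rank-zeroMap ⟩
      suc (n ∸ pred (n ∸ r + 1))  ≡⟨ cong (λ K → suc (n ∸ pred K)) (+-comm (n ∸ r) 1) ⟩
      suc (n ∸ (n ∸ r))           ≡⟨ cong suc (m∸[m∸n]≡n r≤n) ⟩
      suc r                       ∎
    length≡ : length N ≡ ξ (n ∸ r + 1)
    length≡ = begin
      length N                          ≡⟨ length-N ⟩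
      suc t ^ (n ∸ r + 1 ∸ suc t)       ≡⟨ cong (λ K → suc t ^ (K ∸ suc t)) K≡ ⟩
      suc t ^ (suc t + e ∸ suc t)       ≡⟨ cong (suc t ^_) (m+n∸m≡n (suc t) e) ⟩
      suc t ^ e                         ≡⟨ ξK≡ ⟨
      ξ (n ∸ r + 1)                     ∎

maxNullSizeRank : ∀ n r → 1 ≤ r → r ≤ n → IsMaxNullSizeRank n r (ξ (n ∸ r + 1))
maxNullSizeRank zero    (suc r) _ ()
maxNullSizeRank (suc n) r 1≤r r≤n =
    nullSubsemigroupOfRank r 1≤r r≤n
  , λ S z S-null rank≡r →
      subst (λ r → length S ≤ ξ (suc n ∸ r + 1)) rank≡r (NullSubsemigroup.length≤ξ S-null)

maxNullSizeRank-unique : ∀ {n r a b} → IsMaxNullSizeRank n r a → IsMaxNullSizeRank n r b → a ≡ b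
maxNullSizeRank-unique ((S , z , S-null , rank≡ , length≡a) , ≤a)
                       ((S′ , z′ , S′-null , rank′≡ , length≡b) , ≤b) =
  ≤-antisym (subst (_≤ _) length≡a (≤b S z S-null rank≡))
            (subst (_≤ _) length≡b (≤a S′ z′ S′-null rank′≡))

maxNullSize : ∀ n → 1 ≤ n → IsMaxNullSize n (ξ n)
maxNullSize (suc n) _ with S , z , S-null , _ , length≡ ← nullSubsemigroupOfRank 1 ≤-refl (s≤s z≤n) =
  (S , z , S-null , trans length≡ (cong ξ (+-comm n 1))) ,
  λ S z S-null → ≤-trans (NullSubsemigroup.length≤ξ S-null)
                         (ξ-mono-≤ ([1+n∸r]+1≤1+n n (rank z) (rank-positive z)))

ξ-rank-decreasing : ∀ n r → r + 1 ≤ n → ξ (suc n ∸ (r + 1) + 1) < ξ (suc n ∸ r + 1)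
ξ-rank-decreasing n r r+1≤n rewrite +-comm r 1 = begin-strict
  ξ (n ∸ r + 1)          <⟨ ξ-<-suc (n ∸ r + 1) (+-monoˡ-≤ 1 (m+n≤o⇒m≤o∸n 1 r+1≤n)) ⟩
  ξ (suc (n ∸ r + 1))    ≡⟨ cong (λ m → ξ (m + 1)) (+-∸-assoc 1 (≤-trans (n≤1+n r) r+1≤n)) ⟨
  ξ (suc n ∸ r + 1)      ∎
  where open ≤-Reasoning

maximumNullSubsemigroup : ∀ n → 1 ≤ n →
  Σ (List (Transformation n)) λ S → Σ (Transformation n) λ z →
    ((f : Transformation n) → (f ∈ S) ⇔ InN n f) × IsNullSubsemigroup S z × length S ≡ ξ n
maximumNullSubsemigroup (suc n) 1≤n with 1≤α , α≤n , ξ≡ ← α-attained (suc n) 1≤n =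
  N , zeroMap , (λ f → ⇔.trans (∈N⇔ f) (allowed⇔InN {f})) , N-isNull , trans length-N (sym ξ≡)
  where
    open Construction {n} (α (suc n)) (suc n) 1≤α α≤n ≤-refl
    allowed⇔InN : ∀ {f} → (∀ i → Allowed i (lookup f i)) ⇔ InN (suc n) f
    allowed⇔InN = mk⇔
      (λ allowed → (λ i → proj₁ (proj₂ (allowed i)) (toℕ<n i))
                 , (λ i i<α → cong toℕ (proj₁ (allowed i) i<α)))
      (λ (into , kill) i → (λ i<α → toℕ-injective (kill i i<α))
                         , (λ _ → into i)
                         , (λ n<i → ⊥-elim (<⇒≱ (toℕ<n i) n<i)))

theorem4p4 : (n : ℕ) → 1 ≤ n →
      ((r : ℕ) → 1 ≤ r → r ≤ n → IsMaxNullSizeRank n r (ξ (n ∸ r + 1)))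
    × ((r m m′ : ℕ) → 1 ≤ r → r + 1 ≤ n ∸ 1 →
          IsMaxNullSizeRank n r m → IsMaxNullSizeRank n (r + 1) m′ → m′ < m)
    × (2 ≤ n → (m : ℕ) → IsMaxNullSizeRank n (n ∸ 1) m → m ≡ 1)
    × ((m : ℕ) → IsMaxNullSizeRank n n m → m ≡ 1)
    × IsMaxNullSize n (ξ n)
    × ((m : ℕ) → IsMaxNullSizeRank n 1 m → m ≡ ξ n)
    × (Σ (List (Transformation n)) λ S → Σ (Transformation n) λ z →
          ((f : Transformation n) → (f ∈ S) ⇔ InN n f)
        × IsNullSubsemigroup S z
        × length S ≡ ξ n)
theorem4p4 n@(suc n′) 1≤n =
    maxNullSizeRank n
  , (λ r m m′ 1≤r r+1≤n′ m-max m′-max →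
       let r+1≤n = m≤n⇒m≤1+n r+1≤n′ in
       subst₂ _<_ (max≡ m′-max (≤-trans 1≤r (m≤m+n r 1)) r+1≤n)
                  (max≡ m-max 1≤r (≤-trans (m≤m+n r 1) r+1≤n))
         (ξ-rank-decreasing n′ r r+1≤n′))
  -- ξ 2 and ξ 1 evaluate to 1
  , (λ { (s≤s 1≤n′) m m-max →
         trans (sym (max≡ m-max 1≤n′ (n≤1+n n′))) (cong (λ k → ξ (k + 1)) (m+n∸n≡m 1 n′)) })
  , (λ m m-max → trans (sym (max≡ m-max 1≤n ≤-refl)) (cong (λ k → ξ (k + 1)) (n∸n≡0 n)))
  , maxNullSize n 1≤n
  , (λ m m-max → trans (sym (max≡ m-max ≤-refl 1≤n)) (cong ξ (+-comm n′ 1)))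
  , maximumNullSubsemigroup n 1≤n
  where
    max≡ : ∀ {r m} → IsMaxNullSizeRank n r m → 1 ≤ r → r ≤ n → ξ (n ∸ r + 1) ≡ m
    max≡ m-max 1≤r r≤n = maxNullSizeRank-unique (maxNullSizeRank n _ 1≤r r≤n) m-max
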